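{- Let $G$ be a bipartite graph with bipartition $\{M,N\}$ such that $|N|\ge |M|\ge 3$ and $\delta(M)\ge |N|-1$. If $M$ contains at least two vertices each of which is adjacent to every vertex of $N$, then $G$ contains a cycle of length $2|M|$.
   Context: For a bipartite graph $G$ with bipartition $\{M,N\}$, $\delta(M)=\min\{d_G(x):x\in M\}$. -}

module Defs where

open import Data.Nat using (ℕ; zero; suc; _<?_)
open import Data.Fin using (Fin; zero; suc; toℕ; fromℕ<)
open import Data.Bool using (Bool; true; T?)
open import Data.List using (length; filter)
open import Data.List using (List)
import Data.List.Base
open import Data.Product using (_×_)
open import Function.Definitions using (Injective)
open import Relation.Binary.PropositionalEquality using (_≡_)
open import Relation.Nullary using (yes; no)

-- A finite simple bipartite graph with bipartition {M, N}, M = Fin m, N = Fin n.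
-- adj x y = true  iff  x ∈ M and y ∈ N are adjacent (all edges go between M and N).
BipartiteGraph : ℕ → ℕ → Set
BipartiteGraph m n = Fin m → Fin n → Bool

allFin : (n : ℕ) → List (Fin n)
allFin n = Data.List.Base.tabulate (λ i → i)

degM : ∀ {m n} → BipartiteGraph m n → Fin m → ℕ
degM {n = n} G x = length (filter (λ y → T? (G x y)) (allFin n))

next : ∀ {k} → Fin k → Fin k
next {suc k} i with suc (toℕ i) <? suc k
... | yes p = fromℕ< p
... | no _  = zero

-- Since G is bipartite, every
-- cycle alternates between M and N, so a cycle of length 2k is
--   x₀ y₀ x₁ y₁ … x_{k-1} y_{k-1} x₀
-- with pairwise distinct xᵢ ∈ M, pairwise distinct yᵢ ∈ N, xᵢ ~ yᵢ and yᵢ ~ x_{i+1 mod k}.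
-- (For k ≥ 2 this is a genuine cycle of length 2k ≥ 4.)
record Cycle {m n} (G : BipartiteGraph m n) (k : ℕ) : Set where
  field
    xs     : Fin k → Fin m
    ys     : Fin k → Fin n
    xs-inj : Injective _≡_ _≡_ xs
    ys-inj : Injective _≡_ _≡_ ys
    edge₁  : ∀ i → G (xs i) (ys i) ≡ true
    edge₂  : ∀ i → G (xs (next i)) (ys i) ≡ true

HasCycleOfLength : ∀ {m n} → BipartiteGraph m n → ℕ → Set
HasCycleOfLength G ℓ = Data.Product.Σ ℕ (λ k → (ℓ ≡ k Data.Nat.+ k) × Cycle G k)

-- Every vertex of M misses at most one vertex of N, so any two vertices of M
-- have a common neighbour as long as |N| ≥ 3.  Starting at the full vertex a,
-- walk greedily: from the current vertex x step through a common neighbour y to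
-- a vertex that is neither x nor the other full vertex b, delete x and y, and
-- repeat; deleting one vertex from each side keeps |N| ≥ |M|.  When only x and
-- b remain, step to b, then to any remaining vertex y of N.  Since a is full,
-- y is adjacent to a, which closes the path into a cycle through all of M.
module Submission where

open import Defs
open import Data.Nat using (ℕ; _≤_; _∸_; _*_; zero; suc; _+_; _<?_; s≤s; s≤s⁻¹)
open import Data.Nat.Properties using (+-identityʳ; ≤-trans; n≮n; n≤1+n)
open import Data.Fin using (Fin; zero; suc; toℕ; fromℕ; inject₁; punchIn; punchOut)
open import Data.Fin.Properties
  using (toℕ<n; toℕ-injective; toℕ-fromℕ; toℕ-fromℕ<; toℕ-inject₁; punchIn-injective; punchInᵢ≢i; punchIn-punchOut)
open import Data.Fin.Relation.Unary.Top using (view; ‵fromℕ; ‵inject₁)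
open import Data.Bool using (true; false; T; T?)
open import Data.Product using (Σ; _×_; _,_)
open import Data.List using (List; _∷_; length; filter)
open import Data.List.Properties using (filter-notAll; length-tabulate)
open import Data.List.Relation.Unary.Any using (here; there)
open import Data.List.Membership.Propositional using (_∈_; lose)
open import Data.List.Membership.Propositional.Properties using (∈-tabulate⁺)
open import Data.Vec.Functional using () renaming (_∷_ to _∷ᶠ_)
open import Function using (_∘_)
open import Function.Definitions using (Injective)
open import Level using (Level)
open import Relation.Nullary using (¬_; yes; no; contradiction)
open import Relation.Unary using (Pred; Decidable)
open import Relation.Binary.PropositionalEquality
  using (_≡_; _≢_; refl; sym; trans; cong; subst)

module _ {a p : Level} {A : Set a} {P : Pred A p} (P? : Decidable P) where

  length-filter-two-rejected : ∀ {xs : List A} {u v} → u ≢ v → u ∈ xs → v ∈ xs →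
    ¬ P u → ¬ P v → 2 + length (filter P? xs) ≤ length xs
  length-filter-two-rejected {x ∷ xs} u≢v u∈ v∈ ¬Pu ¬Pv with P? x | u∈ | v∈
  ... | _      | here refl | here refl = contradiction refl u≢v
  ... | yes Px | here refl | there _   = contradiction Px ¬Pu
  ... | yes Px | there _   | here refl = contradiction Px ¬Pv
  ... | no _   | here refl | there v∈′ = s≤s (filter-notAll P? xs (lose v∈′ ¬Pv))
  ... | no _   | there u∈′ | here refl = s≤s (filter-notAll P? xs (lose u∈′ ¬Pu))
  ... | yes _  | there u∈′ | there v∈′ = s≤s (length-filter-two-rejected u≢v u∈′ v∈′ ¬Pu ¬Pv)
  ... | no _   | there u∈′ | there v∈′ =
    ≤-trans (length-filter-two-rejected u≢v u∈′ v∈′ ¬Pu ¬Pv) (n≤1+n _)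

MissesAtMostOne : ∀ {m n} → BipartiteGraph m n → Set
MissesAtMostOne G = ∀ x {y₁ y₂} → y₁ ≢ y₂ → G x y₁ ≡ false → G x y₂ ≡ true

Full : ∀ {m n} → BipartiteGraph m n → Fin m → Set
Full G x = ∀ y → G x y ≡ true

missesAtMostOne-of-degree : ∀ {m n} (G : BipartiteGraph m n) →
  (∀ x → n ∸ 1 ≤ degM G x) → MissesAtMostOne G
missesAtMostOne-of-degree {n = n} G deg x {y₁} {y₂} y₁≢y₂ x≁y₁ with G x y₂ in x~y₂
... | true  = refl
... | false = contradiction (deg x) (too-small two-missing)
  where
  rejected : ∀ {y} → G x y ≡ false → ¬ T (G x y)
  rejected x≁y t rewrite x≁y = t
  two-missing : 2 + degM G x ≤ n
  two-missing = subst (2 + degM G x ≤_) (length-tabulate (λ i → i))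
    (length-filter-two-rejected (T? ∘ G x) y₁≢y₂ (∈-tabulate⁺ y₁) (∈-tabulate⁺ y₂)
      (rejected x≁y₁) (rejected x~y₂))
  too-small : ∀ {d k} → 2 + d ≤ k → ¬ k ∸ 1 ≤ d
  too-small {d} (s≤s 1+d≤k′) k′≤d = n≮n d (≤-trans 1+d≤k′ k′≤d)

_∖[_,_] : ∀ {m n} → BipartiteGraph (suc m) (suc n) → Fin (suc m) → Fin (suc n) →
  BipartiteGraph m n
(G ∖[ x , y ]) u v = G (punchIn x u) (punchIn y v)

missesAtMostOne-∖ : ∀ {m n} {G : BipartiteGraph (suc m) (suc n)} {x y} →
  MissesAtMostOne G → MissesAtMostOne (G ∖[ x , y ])
missesAtMostOne-∖ {y = y} miss u v₁≢v₂ = miss _ (v₁≢v₂ ∘ punchIn-injective y _ _)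

neighbour : ∀ {m n} {G : BipartiteGraph m (2 + n)} → MissesAtMostOne G →
  ∀ x → Σ (Fin (2 + n)) λ y → G x y ≡ true
neighbour {G = G} miss x with G x zero in x~0
... | true  = zero , x~0
... | false = suc zero , miss x (λ ()) x~0

commonNeighbour-of-nonadjacent : ∀ {m n} {G : BipartiteGraph m (3 + n)} →
  MissesAtMostOne G → ∀ {x} → G x zero ≡ false →
  ∀ x′ → Σ (Fin (3 + n)) λ y → G x y ≡ true × G x′ y ≡ true
commonNeighbour-of-nonadjacent {G = G} miss {x} x≁0 x′ with G x′ (suc zero) in x′~1
... | true  = suc zero , miss x (λ ()) x≁0 , x′~1
... | false = suc (suc zero) , miss x (λ ()) x≁0 , miss x′ (λ ()) x′~1

commonNeighbour : ∀ {m n} {G : BipartiteGraph m (3 + n)} → MissesAtMostOne G →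
  ∀ x x′ → Σ (Fin (3 + n)) λ y → G x y ≡ true × G x′ y ≡ true
commonNeighbour {G = G} miss x x′ with G x zero in x~0 | G x′ zero in x′~0
... | true  | true  = zero , x~0 , x′~0
... | false | _     = commonNeighbour-of-nonadjacent miss x~0 x′
... | true  | false = let y , x′y , xy = commonNeighbour-of-nonadjacent miss x′~0 x in y , xy , x′y

next-fromℕ : ∀ k → next (fromℕ k) ≡ zero
next-fromℕ k with suc (toℕ (fromℕ k)) <? suc k
... | yes k<k = contradiction (subst (λ t → suc t ≤ k) (toℕ-fromℕ k) (s≤s⁻¹ k<k)) (n≮n k)
... | no _    = refl

next-inject₁ : ∀ {k} (j : Fin k) → next (inject₁ j) ≡ suc j
next-inject₁ {k} j with suc (toℕ (inject₁ j)) <? suc k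
... | yes j<k = toℕ-injective (trans (toℕ-fromℕ< j<k) (cong suc (toℕ-inject₁ j)))
... | no j≮k  = contradiction (s≤s (subst (λ t → suc t ≤ k) (sym (toℕ-inject₁ j)) (toℕ<n j))) j≮k

-- The alternating path x₀ y₀ x₁ y₁ … x_k y_k with x₀ = x; it ends in N.
record Path {m n} (G : BipartiteGraph m n) (k : ℕ) (x : Fin m) : Set where
  field
    xs     : Fin (suc k) → Fin m
    ys     : Fin (suc k) → Fin n
    xs-inj : Injective _≡_ _≡_ xs
    ys-inj : Injective _≡_ _≡_ ys
    edge₁  : ∀ i → G (xs i) (ys i) ≡ true
    edge₂  : ∀ j → G (xs (suc j)) (ys (inject₁ j)) ≡ true
    start  : xs zero ≡ x

edgePath : ∀ {m n} {G : BipartiteGraph m n} {x y} → G x y ≡ true → Path G 0 x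
edgePath {x = x} {y} x~y = record
  { xs = λ _ → x ; ys = λ _ → y
  ; xs-inj = λ { {zero} {zero} _ → refl } ; ys-inj = λ { {zero} {zero} _ → refl }
  ; edge₁ = λ _ → x~y ; edge₂ = λ () ; start = refl }

∷-punchIn-injective : ∀ {k m} {f : Fin k → Fin m} (x : Fin (suc m)) →
  Injective _≡_ _≡_ f → Injective _≡_ _≡_ (x ∷ᶠ (punchIn x ∘ f))
∷-punchIn-injective         x f-inj {zero}  {zero}  _ = refl
∷-punchIn-injective {f = f} x f-inj {zero}  {suc j} e = contradiction (sym e) (punchInᵢ≢i x (f j))
∷-punchIn-injective {f = f} x f-inj {suc i} {zero}  e = contradiction e (punchInᵢ≢i x (f i))
∷-punchIn-injective         x f-inj {suc i} {suc j} e = cong suc (f-inj (punchIn-injective x _ _ e))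

prepend : ∀ {m n k} {G : BipartiteGraph (suc m) (suc n)} {x y x′} →
  G x y ≡ true → G (punchIn x x′) y ≡ true → Path (G ∖[ x , y ]) k x′ → Path G (suc k) x
prepend {G = G} {x} {y} x~y x′~y P = record
  { xs = x ∷ᶠ (punchIn x ∘ xs)
  ; ys = y ∷ᶠ (punchIn y ∘ ys)
  ; xs-inj = ∷-punchIn-injective x xs-inj
  ; ys-inj = ∷-punchIn-injective y ys-inj
  ; edge₁ = λ { zero → x~y ; (suc i) → edge₁ i }
  ; edge₂ = λ { zero → subst (λ u → G (punchIn x u) y ≡ true) (sym start) x′~y ; (suc j) → edge₂ j }
  ; start = refl }
  where open Path P

closePath : ∀ {m n k} {G : BipartiteGraph m n} {x} (P : Path G k x) →
  G x (Path.ys P (fromℕ k)) ≡ true → Cycle G (suc k)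
closePath {k = k} {G} {x} P x~last = record
  { xs = xs ; ys = ys ; xs-inj = xs-inj ; ys-inj = ys-inj ; edge₁ = edge₁ ; edge₂ = closingEdge₂ }
  where
  open Path P
  closingEdge₂ : ∀ i → G (xs (next i)) (ys i) ≡ true
  closingEdge₂ i with view i
  ... | ‵fromℕ     = subst (λ u → G (xs u) (ys (fromℕ k)) ≡ true) (sym (next-fromℕ k))
                       (subst (λ u → G u (ys (fromℕ k)) ≡ true) (sym start) x~last)
  ... | ‵inject₁ j = subst (λ u → G (xs u) (ys (inject₁ j)) ≡ true) (sym (next-inject₁ j)) (edge₂ j)

hamiltonianPath : ∀ k {n} (G : BipartiteGraph (2 + k) n) {b x} → 2 + k ≤ n →
  MissesAtMostOne G → Full G b → x ≢ b → Path G (suc k) x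
hamiltonianPath zero {suc (suc n)} G {b} {x} (s≤s (s≤s _)) miss b-full x≢b
  with neighbour miss x
... | y , x~y = prepend x~y (b′-full y) (edgePath (b′-full (punchIn y zero)))
  where
  b′-full : Full G (punchIn x (punchOut x≢b))
  b′-full = subst (Full G) (sym (punchIn-punchOut x≢b)) b-full
hamiltonianPath (suc k) {suc (suc (suc n))} G {b} {x} (s≤s 2+k≤n@(s≤s (s≤s _))) miss b-full x≢b
  -- the next vertex, punchIn (punchOut x≢b) zero in G ∖[ x , y ], is neither x nor b
  with commonNeighbour miss x (punchIn x (punchIn (punchOut x≢b) zero))
... | y , x~y , x₁~y = prepend x~y x₁~y
  (hamiltonianPath k (G ∖[ x , y ]) 2+k≤n (missesAtMostOne-∖ miss) (b′-full ∘ punchIn y) (punchInᵢ≢i b′ zero))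
  where
  b′ : Fin (2 + k)
  b′ = punchOut x≢b
  b′-full : Full G (punchIn x b′)
  b′-full = subst (Full G) (sym (punchIn-punchOut x≢b)) b-full

corollary3p5 : (m n : ℕ) (G : BipartiteGraph m n) →
    3 ≤ m → m ≤ n →
    (∀ x → n ∸ 1 ≤ degM G x) →
    Σ (Fin m) (λ x₁ → Σ (Fin m) (λ x₂ →
    x₁ ≢ x₂ × (∀ y → G x₁ y ≡ true) × (∀ y → G x₂ y ≡ true))) →
    HasCycleOfLength G (2 * m)
corollary3p5 m@(suc (suc k)) n G (s≤s (s≤s _)) m≤n deg (a , b , a≢b , a-full , b-full) =
  m , cong (m +_) (+-identityʳ m) , closePath path (a-full _)
  where
  path : Path G (suc k) a
  path = hamiltonianPath k G m≤n (missesAtMostOne-of-degree G deg) b-full a≢b
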